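{- Let $\alpha$ be a (nondegenerate) $d$-simplex in the $d$-cube and let $\sigma$ be an exterior $d'$-face of $\alpha$. Then the class of $\sigma$ divides the class of $\alpha$. In particular, if $d'=d-1$, then the class of $\sigma$ equals the class of $\alpha$.
   Context: A $d$-simplex in the $d$-cube is the convex hull of $d+1$ affinely independent points of $\{0,1\}^d$. A $j$-face of the cube $[0,1]^d$ is obtained by fixing $d-j$ specified coordinates to specified values in $\{0,1\}$. A $j$-face of a simplex is the convex hull of $j+1$ of its vertices; it is exterior if it is contained in some $j$-face of the cube. The class of $\alpha$, with vertices $v_0,\dots,v_d$, is $|\det|$ of the $(d+1)\times(d+1)$ matrix with rows $(1,v_i)$, i.e. $d!\,\mathrm{vol}(\alpha)$. For an exterior $j$-face $\sigma$ with vertices $w_0,\dots,w_j$, let $S$ be the set of $j$ coordinates on which these vertices are not all equal; the class of $\sigma$ is $|\det|$ of the $(j+1)\times(j+1)$ matrix with rows $(1,w_i|_S)$, i.e. $j!$ times the $j$-volume of $\sigma$. -}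

module Defs where

open import Data.Nat using (ℕ; zero; suc)
open import Data.Fin using (Fin; zero; suc; punchIn; toℕ; _<_)
open import Data.Bool using (Bool; true; false)
open import Data.Integer using (ℤ; +_; -_; _+_; _*_; ∣_∣; -1ℤ; _^_)
open import Relation.Binary.PropositionalEquality using (_≡_; _≢_)
open import Data.Product using (∃; _×_)
open import Data.Empty using (⊥)
open import Function.Definitions using (Injective)

Point : ℕ → Set
Point d = Fin d → Bool

bit : Bool → ℤ
bit true  = + 1
bit false = + 0

sumFin : ∀ n → (Fin n → ℤ) → ℤ
sumFin zero    f = + 0
sumFin (suc n) f = f zero + sumFin n (λ k → f (suc k))

det : ∀ n → (Fin n → Fin n → ℤ) → ℤ
det zero    M = + 1
det (suc n) M =
  sumFin (suc n) (λ k → (-1ℤ ^ toℕ k) * (M zero k * det n (λ i j → M (suc i) (punchIn k j))))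

homMatrix : ∀ n → (Fin (suc n) → Fin n → ℤ) → Fin (suc n) → Fin (suc n) → ℤ
homMatrix n w i zero    = + 1
homMatrix n w i (suc c) = w i c

simplexClass : ∀ d → (Fin (suc d) → Point d) → ℕ
simplexClass d v = ∣ det (suc d) (homMatrix d (λ i c → bit (v i c))) ∣

Nondegenerate : ∀ d → (Fin (suc d) → Point d) → Set
Nondegenerate d v = det (suc d) (homMatrix d (λ i c → bit (v i c))) ≢ + 0

StrictlyIncreasing : ∀ {j d} → (Fin j → Fin d) → Set
StrictlyIncreasing F = ∀ a b → a < b → F a < F b

InImage : ∀ {j d} → (Fin j → Fin d) → Fin d → Set
InImage F c = ∃ λ a → F a ≡ c

InCubeFace : ∀ {j d} → (Fin j → Fin d) → (Fin (suc j) → Point d) → Set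
InCubeFace F w = ∀ c → (InImage F c → ⊥) → ∀ i → w i c ≡ w zero c

faceClass : ∀ j {d} → (Fin j → Fin d) → (Fin (suc j) → Point d) → ℕ
faceClass j F w = ∣ det (suc j) (homMatrix j (λ i a → bit (w i (F a)))) ∣

{-# OPTIONS --safe #-}
-- List the vertices of α with those of σ first and subtract the last vertex of σ from the other
-- j.  Since σ lies in the cube face whose free coordinates are F, these j difference rows vanish
-- on the column of ones and on every coordinate outside F, so the matrix of α is block
-- triangular: |det α| = |det A| · |det B|, where A is the j × j matrix of the edge vectors of σ
-- restricted to F and B again has rows (1, 0/1-vector).  The same splitting applied to σ alone
-- gives class σ = |det A|.  If j = d - 1, B is a nonsingular 2 × 2 matrix of this shape, so
-- |det B| = 1.
module Submission where

open import Defs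
open import Data.Nat using (ℕ; suc)
open import Data.Fin using (Fin)
open import Data.Nat.Divisibility using (_∣_)
open import Data.Product using (_×_)
open import Relation.Binary.PropositionalEquality using (_≡_)
open import Function.Definitions using (Injective)

import Data.Integer.Properties as ℤ
open import Algebra.Properties.Semiring.Sum ℤ.+-*-semiring
  using (sum; sum-syntax; sum-cong-≗; sum-replicate-zero; sum-remove; ∑-distrib-+; ∑-comm;
         *-distribˡ-sum)
open import Data.Bool using (Bool; true; false)
open import Data.Empty using (⊥; ⊥-elim)
open import Data.Fin as Fin using (zero; suc; punchIn; punchOut; toℕ; fromℕ; inject₁)
open import Data.Fin.Properties
  using (punchInᵢ≢i; punchIn-injective; punchIn-punchOut; punchOut-punchIn; punchOut-cong;
         punchOut-injective; suc-injective; lift-injective)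
  renaming (_≟_ to _≟ᶠ_)
open import Data.Integer using (ℤ; +_; -_; _+_; _*_; _-_; ∣_∣; -1ℤ; _^_; 0ℤ; 1ℤ)
open import Data.Integer.Tactic.RingSolver using (solve-∀)
open import Data.Nat as ℕ using (zero)
import Data.Nat.Properties as ℕ
open import Data.Nat.Divisibility using (m∣m*n)
open import Data.Product using (Σ; ∃; _,_; proj₂)
open import Function using (_∘_)
open import Relation.Binary.PropositionalEquality
  using (_≢_; refl; sym; trans; cong; cong₂; subst; subst₂; module ≡-Reasoning)
open import Relation.Nullary using (yes; no)

sign : ℕ → ℤ
sign m = -1ℤ ^ m

sign-suc : ∀ m → sign (suc m) ≡ - sign m
sign-suc m = ℤ.-1*i≡-i (sign m)

∣sign∣≡1 : ∀ m → ∣ sign m ∣ ≡ 1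
∣sign∣≡1 zero    = refl
∣sign∣≡1 (suc m) = trans (cong ∣_∣ (sign-suc m)) (trans (ℤ.∣-i∣≡∣i∣ (sign m)) (∣sign∣≡1 m))

∣u*i∣≡∣i∣ : ∀ u i → ∣ u ∣ ≡ 1 → ∣ u * i ∣ ≡ ∣ i ∣
∣u*i∣≡∣i∣ u i ∣u∣≡1 =
  trans (ℤ.abs-* u i) (trans (cong (ℕ._* ∣ i ∣) ∣u∣≡1) (ℕ.*-identityˡ ∣ i ∣))

∣unit*i*j∣ : ∀ u i j → ∣ u ∣ ≡ 1 → ∣ u * i * j ∣ ≡ ∣ i ∣ ℕ.* ∣ j ∣
∣unit*i*j∣ u i j ∣u∣≡1 =
  trans (cong ∣_∣ (ℤ.*-assoc u i j)) (trans (∣u*i∣≡∣i∣ u (i * j) ∣u∣≡1) (ℤ.abs-* i j))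

unit*i≡0⇒i≡0 : ∀ u i → ∣ u ∣ ≡ 1 → u * i ≡ 0ℤ → i ≡ 0ℤ
unit*i≡0⇒i≡0 u i ∣u∣≡1 u*i≡0 =
  ℤ.∣i∣≡0⇒i≡0 (trans (sym (∣u*i∣≡∣i∣ u i ∣u∣≡1)) (cong ∣_∣ u*i≡0))

i≡-i⇒i≡0 : ∀ {i} → i ≡ - i → i ≡ 0ℤ
i≡-i⇒i≡0 {+ zero} _ = refl

sumFin≡sum : ∀ n (f : Fin n → ℤ) → sumFin n f ≡ sum f
sumFin≡sum zero    f = refl
sumFin≡sum (suc n) f = cong (λ s → f zero + s) (sumFin≡sum n (f ∘ suc))

∑-zero : ∀ {n} {f : Fin n → ℤ} → (∀ k → f k ≡ 0ℤ) → sum f ≡ 0ℤ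
∑-zero {n} f≡0 = trans (sum-cong-≗ f≡0) (sum-replicate-zero n)

∑-neg : ∀ {n} (f : Fin n → ℤ) → ∑[ k < n ] (- f k) ≡ - sum f
∑-neg f = begin
  ∑[ k < _ ] (- f k)      ≡⟨ sum-cong-≗ (λ k → sym (ℤ.-1*i≡-i (f k))) ⟩
  ∑[ k < _ ] (-1ℤ * f k)  ≡⟨ sym (*-distribˡ-sum -1ℤ f) ⟩
  -1ℤ * sum f             ≡⟨ ℤ.-1*i≡-i (sum f) ⟩
  - sum f                 ∎
  where open ≡-Reasoning

Matrix : ℕ → Set
Matrix n = Fin n → Fin n → ℤ

minor : ∀ {n} → Matrix (suc n) → Fin (suc n) → Matrix n
minor M k i j = M (suc i) (punchIn k j)

laplaceTerm : ∀ {n} → Matrix (suc n) → Fin (suc n) → ℤ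
laplaceTerm {n} M k = sign (toℕ k) * (M zero k * det n (minor M k))

det-laplace : ∀ {n} (M : Matrix (suc n)) → det (suc n) M ≡ ∑[ k < suc n ] laplaceTerm M k
det-laplace M = sumFin≡sum _ (laplaceTerm M)

det-cong-minors : ∀ {n} {M N : Matrix (suc n)} → (∀ j → M zero j ≡ N zero j) →
  (∀ k → det n (minor M k) ≡ det n (minor N k)) → det (suc n) M ≡ det (suc n) N
det-cong-minors {n} {M} {N} row₀≡ minors≡ = begin
  det (suc n) M                   ≡⟨ det-laplace M ⟩
  ∑[ k < suc n ] laplaceTerm M k  ≡⟨ sum-cong-≗ term≡ ⟩
  ∑[ k < suc n ] laplaceTerm N k  ≡⟨ det-laplace N ⟨
  det (suc n) N                   ∎
  where
  open ≡-Reasoning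
  term≡ : ∀ k → laplaceTerm M k ≡ laplaceTerm N k
  term≡ k = cong₂ (λ a D → sign (toℕ k) * (a * D)) (row₀≡ k) (minors≡ k)

det-cong : ∀ n {M N : Matrix n} → (∀ i j → M i j ≡ N i j) → det n M ≡ det n N
det-cong zero    M≡N = refl
det-cong (suc n) {M} {N} M≡N =
  det-cong-minors {M = M} {N} (M≡N zero) (λ k → det-cong n (λ i j → M≡N (suc i) (punchIn k j)))

-- Row operations

swap₀₁ : ∀ {n} → Fin (suc (suc n)) → Fin (suc (suc n))
swap₀₁ zero          = suc zero
swap₀₁ (suc zero)    = zero
swap₀₁ (suc (suc i)) = suc (suc i)

punchIn-punchOut-comm : ∀ {n} {k k′ : Fin (suc (suc n))} (k≢k′ : k ≢ k′) (k′≢k : k′ ≢ k) j →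
  punchIn k (punchIn (punchOut k≢k′) j) ≡ punchIn k′ (punchIn (punchOut k′≢k) j)
punchIn-punchOut-comm {_}     {zero}     {zero}     k≢k′ _ j = ⊥-elim (k≢k′ refl)
punchIn-punchOut-comm {_}     {zero}     {suc _}    _    _ j = refl
punchIn-punchOut-comm {_}     {suc _}    {zero}     _    _ j = refl
punchIn-punchOut-comm {zero}  {suc zero} {suc zero} k≢k′ _ j = ⊥-elim (k≢k′ refl)
punchIn-punchOut-comm {suc _} {suc _}    {suc _}    _    _ zero = refl
punchIn-punchOut-comm {suc _} {suc _}    {suc _}    k≢k′ k′≢k (suc j) =
  cong suc (punchIn-punchOut-comm (k≢k′ ∘ cong suc) (k′≢k ∘ cong suc) j)

sign-punchOut-anticomm : ∀ {n} {k k′ : Fin (suc (suc n))} (k≢k′ : k ≢ k′) (k′≢k : k′ ≢ k) →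
  sign (toℕ k) * sign (toℕ (punchOut k≢k′)) ≡ - (sign (toℕ k′) * sign (toℕ (punchOut k′≢k)))
sign-punchOut-anticomm {_}     {zero}     {zero}     k≢k′ _ = ⊥-elim (k≢k′ refl)
sign-punchOut-anticomm {_}     {zero}     {suc k′}   _    _ = lemma (sign (toℕ k′))
  where
  lemma : ∀ s → 1ℤ * s ≡ - (-1ℤ * s * 1ℤ)
  lemma = solve-∀
sign-punchOut-anticomm {_}     {suc k}    {zero}     _    _ = lemma (sign (toℕ k))
  where
  lemma : ∀ s → -1ℤ * s * 1ℤ ≡ - (1ℤ * s)
  lemma = solve-∀
sign-punchOut-anticomm {zero}  {suc zero} {suc zero} k≢k′ _ = ⊥-elim (k≢k′ refl)
sign-punchOut-anticomm {suc _} {suc k}    {suc k′}   k≢k′ k′≢k = begin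
  -1ℤ * sign (toℕ k) * (-1ℤ * sign (toℕ po))       ≡⟨ lemma (sign (toℕ k)) (sign (toℕ po)) ⟩
  sign (toℕ k) * sign (toℕ po)                      ≡⟨ sign-punchOut-anticomm k≢k′∘suc k′≢k∘suc ⟩
  - (sign (toℕ k′) * sign (toℕ po′))                ≡⟨ cong -_ (lemma (sign (toℕ k′)) (sign (toℕ po′))) ⟨
  - (-1ℤ * sign (toℕ k′) * (-1ℤ * sign (toℕ po′)))  ∎
  where
  open ≡-Reasoning
  k≢k′∘suc = k≢k′ ∘ cong suc
  k′≢k∘suc = k′≢k ∘ cong suc
  po = punchOut k≢k′∘suc
  po′ = punchOut k′≢k∘suc
  lemma : ∀ a b → -1ℤ * a * (-1ℤ * b) ≡ a * b
  lemma = solve-∀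

module _ {n : ℕ} (M : Matrix (suc (suc n))) where

  -- The term of the double Laplace expansion along rows 0 and 1 that takes column k from
  -- row 0 and column k′ from row 1.
  pairTerm : Fin (suc (suc n)) → Fin (suc (suc n)) → ℤ
  pairTerm k k′ with k ≟ᶠ k′
  ... | yes _    = 0ℤ
  ... | no k≢k′ = sign (toℕ k) * sign (toℕ (punchOut k≢k′)) * (M zero k * M (suc zero) k′)
                  * det n (λ i j → M (suc (suc i)) (punchIn k (punchIn (punchOut k≢k′) j)))

  private
    pairTerm-punchIn : ∀ k l →
      sign (toℕ k) * (M zero k * laplaceTerm (minor M k) l) ≡ pairTerm k (punchIn k l)
    pairTerm-punchIn k l with k ≟ᶠ punchIn k l
    ... | yes k≡ = ⊥-elim (punchInᵢ≢i k l (sym k≡))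
    ... | no k≢ = trans
      (lemma (sign (toℕ k)) (sign (toℕ l)) (M zero k) (M (suc zero) (punchIn k l))
             (det n (minor (minor M k) l)))
      (cong (λ l′ → sign (toℕ k) * sign (toℕ l′) * (M zero k * M (suc zero) (punchIn k l))
                    * det n (λ i j → M (suc (suc i)) (punchIn k (punchIn l′ j))))
            (sym (trans (punchOut-cong k refl) (punchOut-punchIn k))))
      where
      lemma : ∀ s t a b D → s * (a * (t * (b * D))) ≡ s * t * (a * b) * D
      lemma = solve-∀

    pairTerm-diagonal : ∀ k → pairTerm k k ≡ 0ℤ
    pairTerm-diagonal k with k ≟ᶠ k
    ... | yes _   = refl
    ... | no k≢k = ⊥-elim (k≢k refl)

  laplaceTerm≡∑pairTerm : ∀ k → laplaceTerm M k ≡ ∑[ k′ < suc (suc n) ] pairTerm k k′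
  laplaceTerm≡∑pairTerm k = begin
    sign (toℕ k) * (M zero k * det (suc n) (minor M k))
      ≡⟨ cong (λ D → sign (toℕ k) * (M zero k * D)) (det-laplace (minor M k)) ⟩
    sign (toℕ k) * (M zero k * ∑[ l < suc n ] laplaceTerm (minor M k) l)
      ≡⟨ cong (sign (toℕ k) *_) (*-distribˡ-sum (M zero k) (laplaceTerm (minor M k))) ⟩
    sign (toℕ k) * ∑[ l < suc n ] (M zero k * laplaceTerm (minor M k) l)
      ≡⟨ *-distribˡ-sum (sign (toℕ k)) (λ l → M zero k * laplaceTerm (minor M k) l) ⟩
    ∑[ l < suc n ] (sign (toℕ k) * (M zero k * laplaceTerm (minor M k) l))
      ≡⟨ sum-cong-≗ (pairTerm-punchIn k) ⟩
    ∑[ l < suc n ] pairTerm k (punchIn k l)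
      ≡⟨ trans (cong (_+ ∑[ l < suc n ] pairTerm k (punchIn k l)) (pairTerm-diagonal k))
               (ℤ.+-identityˡ (∑[ l < suc n ] pairTerm k (punchIn k l))) ⟨
    pairTerm k k + ∑[ l < suc n ] pairTerm k (punchIn k l)
      ≡⟨ sum-remove (pairTerm k) ⟨
    ∑[ k′ < suc (suc n) ] pairTerm k k′ ∎
    where open ≡-Reasoning

  det≡∑pairTerm : det (suc (suc n)) M ≡ ∑[ k < suc (suc n) ] ∑[ k′ < suc (suc n) ] pairTerm k k′
  det≡∑pairTerm = trans (det-laplace M) (sum-cong-≗ laplaceTerm≡∑pairTerm)

pairTerm-swap₀₁ : ∀ {n} (M : Matrix (suc (suc n))) k k′ →
  pairTerm (M ∘ swap₀₁) k k′ ≡ - pairTerm M k′ k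
pairTerm-swap₀₁ {n} M k k′ with k ≟ᶠ k′ | k′ ≟ᶠ k
... | yes _    | yes _    = refl
... | yes k≡k′ | no k′≢k = ⊥-elim (k′≢k (sym k≡k′))
... | no k≢k′ | yes k′≡k = ⊥-elim (k≢k′ (sym k′≡k))
... | no k≢k′ | no k′≢k
  rewrite sign-punchOut-anticomm k≢k′ k′≢k
        | det-cong n (λ i j → cong (M (suc (suc i))) (punchIn-punchOut-comm k≢k′ k′≢k j)) =
  lemma (sign (toℕ k′) * sign (toℕ (punchOut k′≢k))) (M zero k′) (M (suc zero) k)
        (det n (λ i j → M (suc (suc i)) (punchIn k′ (punchIn (punchOut k′≢k) j))))
  where
  lemma : ∀ s a b D → - s * (b * a) * D ≡ - (s * (a * b) * D)
  lemma = solve-∀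

det-swap₀₁ : ∀ {n} (M : Matrix (suc (suc n))) →
  det (suc (suc n)) (M ∘ swap₀₁) ≡ - det (suc (suc n)) M
det-swap₀₁ {n} M = begin
  det (suc (suc n)) (M ∘ swap₀₁)
    ≡⟨ det≡∑pairTerm (M ∘ swap₀₁) ⟩
  ∑[ k < 2+n ] ∑[ k′ < 2+n ] pairTerm (M ∘ swap₀₁) k k′
    ≡⟨ sum-cong-≗ (λ k → sum-cong-≗ (pairTerm-swap₀₁ M k)) ⟩
  ∑[ k < 2+n ] ∑[ k′ < 2+n ] (- pairTerm M k′ k)
    ≡⟨ sum-cong-≗ (λ k → ∑-neg (λ k′ → pairTerm M k′ k)) ⟩
  ∑[ k < 2+n ] (- ∑[ k′ < 2+n ] pairTerm M k′ k)
    ≡⟨ ∑-neg (λ k → ∑[ k′ < 2+n ] pairTerm M k′ k) ⟩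
  - ∑[ k < 2+n ] ∑[ k′ < 2+n ] pairTerm M k′ k
    ≡⟨ cong -_ (∑-comm (λ k k′ → pairTerm M k′ k)) ⟩
  - ∑[ k′ < 2+n ] ∑[ k < 2+n ] pairTerm M k′ k
    ≡⟨ cong -_ (det≡∑pairTerm M) ⟨
  - det (suc (suc n)) M
    ∎
  where
  open ≡-Reasoning
  2+n = suc (suc n)

det≡-det-swap₀₁ : ∀ {n} (M : Matrix (suc (suc n))) →
  det (suc (suc n)) M ≡ - det (suc (suc n)) (M ∘ swap₀₁)
det≡-det-swap₀₁ M = trans (sym (ℤ.neg-involutive _)) (cong -_ (sym (det-swap₀₁ M)))

det-row₀≡row₁ : ∀ {n} (M : Matrix (suc (suc n))) → (∀ j → M zero j ≡ M (suc zero) j) →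
  det (suc (suc n)) M ≡ 0ℤ
det-row₀≡row₁ {n} M row₀≡row₁ =
  i≡-i⇒i≡0 (trans (det≡-det-swap₀₁ M) (cong -_ (det-cong (suc (suc n)) swapped)))
  where
  swapped : ∀ r j → M (swap₀₁ r) j ≡ M r j
  swapped zero          j = sym (row₀≡row₁ j)
  swapped (suc zero)    j = row₀≡row₁ j
  swapped (suc (suc r)) j = refl

-- A record rather than a function type, so that π and c can be inferred from its proofs.
record ScalesDet (n : ℕ) (π : Fin n → Fin n) (c : ℤ) : Set where
  field
    det-∘ : ∀ (M : Matrix n) → det n (M ∘ π) ≡ c * det n M

open ScalesDet

scalesDet-cong : ∀ {n} {π σ : Fin n → Fin n} {c} → (∀ r → π r ≡ σ r) → ScalesDet n π c → ScalesDet n σ c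
scalesDet-cong {n} π≗σ π-scales .det-∘ M =
  trans (det-cong n (λ r j → cong (λ r′ → M r′ j) (sym (π≗σ r)))) (π-scales .det-∘ M)

scalesDet-∘ : ∀ {n} {π σ : Fin n → Fin n} {a b} →
  ScalesDet n π a → ScalesDet n σ b → ScalesDet n (π ∘ σ) (b * a)
scalesDet-∘ {n} {π} {σ} {a} {b} π-scales σ-scales .det-∘ M = begin
  det n (M ∘ π ∘ σ)    ≡⟨ σ-scales .det-∘ (M ∘ π) ⟩
  b * det n (M ∘ π)    ≡⟨ cong (b *_) (π-scales .det-∘ M) ⟩
  b * (a * det n M)    ≡⟨ ℤ.*-assoc b a (det n M) ⟨
  b * a * det n M      ∎
  where open ≡-Reasoning

scalesDet-lift : ∀ {n} {π : Fin n → Fin n} {c} → ScalesDet n π c → ScalesDet (suc n) (Fin.lift 1 π) c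
scalesDet-lift {n} {π} {c} π-scales .det-∘ M = begin
  det (suc n) (M ∘ Fin.lift 1 π)                    ≡⟨ det-laplace (M ∘ Fin.lift 1 π) ⟩
  ∑[ k < suc n ] laplaceTerm (M ∘ Fin.lift 1 π) k   ≡⟨ sum-cong-≗ term≡ ⟩
  ∑[ k < suc n ] (c * laplaceTerm M k)              ≡⟨ *-distribˡ-sum c (laplaceTerm M) ⟨
  c * ∑[ k < suc n ] laplaceTerm M k                ≡⟨ cong (c *_) (det-laplace M) ⟨
  c * det (suc n) M                                 ∎
  where
  open ≡-Reasoning
  lemma : ∀ c s a D → s * (a * (c * D)) ≡ c * (s * (a * D))
  lemma = solve-∀
  term≡ : ∀ k → laplaceTerm (M ∘ Fin.lift 1 π) k ≡ c * laplaceTerm M k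
  term≡ k = trans (cong (λ D → sign (toℕ k) * (M zero k * D)) (π-scales .det-∘ (minor M k)))
                  (lemma c (sign (toℕ k)) (M zero k) (det n (minor M k)))

toFront : ∀ {n} → Fin (suc n) → Fin (suc n) → Fin (suc n)
toFront i zero    = i
toFront i (suc r) = punchIn i r

toFront-injective : ∀ {n} (i : Fin (suc n)) → Injective _≡_ _≡_ (toFront i)
toFront-injective i {zero}  {zero}  _  = refl
toFront-injective i {zero}  {suc s} eq = ⊥-elim (punchInᵢ≢i i s (sym eq))
toFront-injective i {suc r} {zero}  eq = ⊥-elim (punchInᵢ≢i i r eq)
toFront-injective i {suc r} {suc s} eq = cong suc (punchIn-injective i r s eq)

scalesDet-toFront : ∀ {n} (i : Fin (suc n)) → ScalesDet (suc n) (toFront i) (sign (toℕ i))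
scalesDet-toFront {n} zero .det-∘ M = trans (det-cong (suc n) toFront-zero) (sym (ℤ.*-identityˡ _))
  where
  toFront-zero : ∀ r j → M (toFront zero r) j ≡ M r j
  toFront-zero zero    j = refl
  toFront-zero (suc r) j = refl
scalesDet-toFront {suc n} (suc i) .det-∘ M = begin
  det (suc (suc n)) (M ∘ toFront (suc i))
    ≡⟨ det≡-det-swap₀₁ (M ∘ toFront (suc i)) ⟩
  - det (suc (suc n)) (M ∘ toFront (suc i) ∘ swap₀₁)
    ≡⟨ cong -_ (scalesDet-cong lifted (scalesDet-lift (scalesDet-toFront i)) .det-∘ M) ⟩
  - (sign (toℕ i) * det (suc (suc n)) M)
    ≡⟨ ℤ.neg-distribˡ-* (sign (toℕ i)) (det (suc (suc n)) M) ⟩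
  - sign (toℕ i) * det (suc (suc n)) M
    ≡⟨ cong (_* det (suc (suc n)) M) (sign-suc (toℕ i)) ⟨
  sign (toℕ (suc i)) * det (suc (suc n)) M
    ∎
  where
  open ≡-Reasoning
  lifted : ∀ r → Fin.lift 1 (toFront i) r ≡ toFront (suc i) (swap₀₁ r)
  lifted zero          = refl
  lifted (suc zero)    = refl
  lifted (suc (suc r)) = refl

module _ {m n} {π : Fin (suc m) → Fin (suc n)} (π-injective : Injective _≡_ _≡_ π) where

  private
    π₀≢π∘suc : ∀ r → π zero ≢ π (suc r)
    π₀≢π∘suc r eq with π-injective eq
    ... | ()

  dropHead : Fin m → Fin n
  dropHead r = punchOut (π₀≢π∘suc r)

  dropHead-injective : Injective _≡_ _≡_ dropHead
  dropHead-injective {r} {s} eq =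
    suc-injective (π-injective (punchOut-injective (π₀≢π∘suc r) (π₀≢π∘suc s) eq))

  toFront∘lift-dropHead : ∀ r → toFront (π zero) (Fin.lift 1 dropHead r) ≡ π r
  toFront∘lift-dropHead zero    = refl
  toFront∘lift-dropHead (suc r) = punchIn-punchOut (π₀≢π∘suc r)

det-permute : ∀ n {π : Fin n → Fin n} → Injective _≡_ _≡_ π → ∃ λ c → ∣ c ∣ ≡ 1 × ScalesDet n π c
det-permute zero    _           = 1ℤ , refl , record { det-∘ = λ M → refl }
det-permute (suc n) {π} π-injective with det-permute n (dropHead-injective π-injective)
... | c , ∣c∣≡1 , dropHead-scales =
  c * sign (toℕ (π zero)) ,
  trans (ℤ.abs-* c _) (cong₂ ℕ._*_ ∣c∣≡1 (∣sign∣≡1 (toℕ (π zero)))) ,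
  scalesDet-cong (toFront∘lift-dropHead π-injective)
    (scalesDet-∘ (scalesDet-toFront (π zero)) (scalesDet-lift dropHead-scales))

det-row₀≡row : ∀ {n} (M : Matrix (suc n)) b → (∀ j → M zero j ≡ M (suc b) j) → det (suc n) M ≡ 0ℤ
det-row₀≡row {suc n} M b row₀≡row =
  unit*i≡0⇒i≡0 (sign (toℕ b)) (det (suc (suc n)) M) (∣sign∣≡1 (toℕ b)) (begin
    sign (toℕ b) * det (suc (suc n)) M              ≡⟨ scalesDet-lift (scalesDet-toFront b) .det-∘ M ⟨
    det (suc (suc n)) (M ∘ Fin.lift 1 (toFront b))  ≡⟨ det-row₀≡row₁ (M ∘ Fin.lift 1 (toFront b)) row₀≡row ⟩
    0ℤ                                              ∎)
  where open ≡-Reasoning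

withRow₀ : ∀ {n} → Matrix (suc n) → (Fin (suc n) → ℤ) → Matrix (suc n)
withRow₀ M u zero    j = u j
withRow₀ M u (suc i) j = M (suc i) j

det-withRow₀-linear : ∀ {n} (M : Matrix (suc n)) c (u : Fin (suc n) → ℤ) →
  det (suc n) (withRow₀ M (λ j → M zero j - c * u j)) ≡ det (suc n) M - c * det (suc n) (withRow₀ M u)
det-withRow₀-linear {n} M c u = begin
  det (suc n) (withRow₀ M (λ j → M zero j - c * u j))
    ≡⟨ det-laplace (withRow₀ M (λ j → M zero j - c * u j)) ⟩
  ∑[ k < suc n ] (sign (toℕ k) * ((M zero k - c * u k) * det n (minor M k)))
    ≡⟨ sum-cong-≗ (λ k → lemma (sign (toℕ k)) (M zero k) c (u k) (det n (minor M k))) ⟩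
  ∑[ k < suc n ] (laplaceTerm M k + - (c * laplaceTerm (withRow₀ M u) k))
    ≡⟨ ∑-distrib-+ (laplaceTerm M) (λ k → - (c * laplaceTerm (withRow₀ M u) k)) ⟩
  ∑[ k < suc n ] laplaceTerm M k + ∑[ k < suc n ] (- (c * laplaceTerm (withRow₀ M u) k))
    ≡⟨ cong (λ x → sum (laplaceTerm M) + x)
            (trans (∑-neg (λ k → c * laplaceTerm (withRow₀ M u) k))
                   (cong -_ (sym (*-distribˡ-sum c (laplaceTerm (withRow₀ M u)))))) ⟩
  ∑[ k < suc n ] laplaceTerm M k - c * ∑[ k < suc n ] laplaceTerm (withRow₀ M u) k
    ≡⟨ cong₂ (λ D D′ → D - c * D′) (det-laplace M) (det-laplace (withRow₀ M u)) ⟨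
  det (suc n) M - c * det (suc n) (withRow₀ M u)
    ∎
  where
  open ≡-Reasoning
  lemma : ∀ s a c b D → s * ((a - c * b) * D) ≡ s * (a * D) + - (c * (s * (b * D)))
  lemma = solve-∀

-- Row 0 is handled by linearity, the correction term having row 0 equal to row b, and the other
-- rows by induction on the minors; for b = 0 the first two rows are exchanged first.
mutual
  det-subtractRow : ∀ n (M : Matrix n) b (t : Fin n → ℤ) → t b ≡ 0ℤ →
    det n (λ r j → M r j - t r * M b j) ≡ det n M
  det-subtractRow (suc zero)    M zero    t t-b≡0 =
    det-cong 1 {λ r j → M r j - t r * M zero j} {M}
      λ { zero j → trans (cong (λ s → M zero j - s * M zero j) t-b≡0) (ℤ.+-identityʳ (M zero j)) }
  det-subtractRow (suc (suc n)) M zero    t t-b≡0 = begin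
    det (suc (suc n)) (λ r j → M r j - t r * M zero j)
      ≡⟨ det≡-det-swap₀₁ (λ r j → M r j - t r * M zero j) ⟩
    - det (suc (suc n)) (λ r j → M (swap₀₁ r) j - t (swap₀₁ r) * M zero j)
      ≡⟨ cong -_ (det-subtractRow-suc (suc n) (M ∘ swap₀₁) zero (t ∘ swap₀₁) t-b≡0) ⟩
    - det (suc (suc n)) (M ∘ swap₀₁)
      ≡⟨ det≡-det-swap₀₁ M ⟨
    det (suc (suc n)) M
      ∎
    where open ≡-Reasoning
  det-subtractRow (suc n)       M (suc b) t t-b≡0 = det-subtractRow-suc n M b t t-b≡0

  det-subtractRow-suc : ∀ n (M : Matrix (suc n)) b (t : Fin (suc n) → ℤ) → t (suc b) ≡ 0ℤ →
    det (suc n) (λ r j → M r j - t r * M (suc b) j) ≡ det (suc n) M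
  det-subtractRow-suc n M b t t-b≡0 = begin
    det (suc n) (λ r j → M r j - t r * M (suc b) j)
      ≡⟨ det-cong-minors {M = λ r j → M r j - t r * M (suc b) j}
                         {N = withRow₀ M (λ j → M zero j - t zero * M (suc b) j)}
                         (λ j → refl) (λ k → det-subtractRow n (minor M k) b (t ∘ suc) t-b≡0) ⟩
    det (suc n) (withRow₀ M (λ j → M zero j - t zero * M (suc b) j))
      ≡⟨ det-withRow₀-linear M (t zero) (M (suc b)) ⟩
    det (suc n) M - t zero * det (suc n) (withRow₀ M (M (suc b)))
      ≡⟨ cong (λ D → det (suc n) M - t zero * D) (det-row₀≡row (withRow₀ M (M (suc b))) b (λ j → refl)) ⟩
    det (suc n) M - t zero * 0ℤ
      ≡⟨ cong (λ x → det (suc n) M - x) (ℤ.*-zeroʳ (t zero)) ⟩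
    det (suc n) M - 0ℤ
      ≡⟨ ℤ.+-identityʳ (det (suc n) M) ⟩
    det (suc n) M
      ∎
    where open ≡-Reasoning

-- Shuffles

-- An interleaving of m left and p right positions into Fin n; left κ and right κ enumerate them
-- in increasing order.
data Shuffle : ℕ → ℕ → ℕ → Set where
  []  : Shuffle 0 0 0
  l∷_ : ∀ {m p n} → Shuffle m p n → Shuffle (suc m) p (suc n)
  r∷_ : ∀ {m p n} → Shuffle m p n → Shuffle m (suc p) (suc n)

left : ∀ {m p n} → Shuffle m p n → Fin m → Fin n
left (l∷ κ) zero    = zero
left (l∷ κ) (suc a) = suc (left κ a)
left (r∷ κ) a       = suc (left κ a)

right : ∀ {m p n} → Shuffle m p n → Fin p → Fin n
right (l∷ κ) c       = suc (right κ c)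
right (r∷ κ) zero    = zero
right (r∷ κ) (suc c) = suc (right κ c)

shuffle-size : ∀ {m p n} → Shuffle m p n → n ≡ m ℕ.+ p
shuffle-size []               = refl
shuffle-size (l∷ κ)           = cong suc (shuffle-size κ)
shuffle-size {m} {suc p} (r∷ κ) = trans (cong suc (shuffle-size κ)) (sym (ℕ.+-suc m p))

left≢right : ∀ {m p n} (κ : Shuffle m p n) a c → left κ a ≢ right κ c
left≢right (l∷ κ) (suc a) c       eq = left≢right κ a c (suc-injective eq)
left≢right (r∷ κ) a       (suc c) eq = left≢right κ a c (suc-injective eq)

∑-shuffle : ∀ {m p n} (κ : Shuffle m p n) (g : Fin n → ℤ) → sum g ≡ sum (g ∘ left κ) + sum (g ∘ right κ)
∑-shuffle []     g = refl
∑-shuffle (l∷ κ) g = trans (cong (λ s → g zero + s) (∑-shuffle κ (g ∘ suc)))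
                           (sym (ℤ.+-assoc (g zero) (sum (g ∘ suc ∘ left κ)) (sum (g ∘ suc ∘ right κ))))
∑-shuffle (r∷ κ) g = trans (cong (λ s → g zero + s) (∑-shuffle κ (g ∘ suc)))
                           (lemma (g zero) (sum (g ∘ suc ∘ left κ)) (sum (g ∘ suc ∘ right κ)))
  where
  lemma : ∀ x a b → x + (a + b) ≡ a + (x + b)
  lemma = solve-∀

-- The sign of the permutation listing the left positions of κ before its right ones: every
-- right position has to be moved past the left positions that follow it.
shuffleSign : ∀ {m p n} → Shuffle m p n → ℤ
shuffleSign []            = 1ℤ
shuffleSign (l∷ κ)        = shuffleSign κ
shuffleSign (r∷_ {m} κ)   = sign m * shuffleSign κ

∣shuffleSign∣≡1 : ∀ {m p n} (κ : Shuffle m p n) → ∣ shuffleSign κ ∣ ≡ 1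
∣shuffleSign∣≡1 []          = refl
∣shuffleSign∣≡1 (l∷ κ)      = ∣shuffleSign∣≡1 κ
∣shuffleSign∣≡1 (r∷_ {m} κ) =
  trans (ℤ.abs-* (sign m) (shuffleSign κ)) (cong₂ ℕ._*_ (∣sign∣≡1 m) (∣shuffleSign∣≡1 κ))

deleteLeft : ∀ {m p n} → Shuffle (suc m) p (suc n) → Fin (suc m) → Shuffle m p n
deleteLeft         (l∷ κ)          zero    = κ
deleteLeft         (l∷ κ@(l∷ _))   (suc a) = l∷ deleteLeft κ a
deleteLeft {suc _} (l∷ κ@(r∷ _))   (suc a) = l∷ deleteLeft κ a
deleteLeft         (r∷ κ@(l∷ _))   a       = r∷ deleteLeft κ a
deleteLeft         (r∷ κ@(r∷ _))   a       = r∷ deleteLeft κ a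

punchIn-left-deleteLeft : ∀ {m p n} (κ : Shuffle (suc m) p (suc n)) a b →
  punchIn (left κ a) (left (deleteLeft κ a) b) ≡ left κ (punchIn a b)
punchIn-left-deleteLeft         (l∷ κ)        zero    b       = refl
punchIn-left-deleteLeft         (l∷ κ@(l∷ _)) (suc a) zero    = refl
punchIn-left-deleteLeft         (l∷ κ@(l∷ _)) (suc a) (suc b) = cong suc (punchIn-left-deleteLeft κ a b)
punchIn-left-deleteLeft {suc _} (l∷ κ@(r∷ _)) (suc a) zero    = refl
punchIn-left-deleteLeft {suc _} (l∷ κ@(r∷ _)) (suc a) (suc b) = cong suc (punchIn-left-deleteLeft κ a b)
punchIn-left-deleteLeft         (r∷ κ@(l∷ _)) a       b       = cong suc (punchIn-left-deleteLeft κ a b)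
punchIn-left-deleteLeft         (r∷ κ@(r∷ _)) a       b       = cong suc (punchIn-left-deleteLeft κ a b)

punchIn-right-deleteLeft : ∀ {m p n} (κ : Shuffle (suc m) p (suc n)) a c →
  punchIn (left κ a) (right (deleteLeft κ a) c) ≡ right κ c
punchIn-right-deleteLeft         (l∷ κ)        zero    c       = refl
punchIn-right-deleteLeft         (l∷ κ@(l∷ _)) (suc a) c       = cong suc (punchIn-right-deleteLeft κ a c)
punchIn-right-deleteLeft {suc _} (l∷ κ@(r∷ _)) (suc a) c       = cong suc (punchIn-right-deleteLeft κ a c)
punchIn-right-deleteLeft         (r∷ κ@(l∷ _)) a       zero    = refl
punchIn-right-deleteLeft         (r∷ κ@(l∷ _)) a       (suc c) = cong suc (punchIn-right-deleteLeft κ a c)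
punchIn-right-deleteLeft         (r∷ κ@(r∷ _)) a       zero    = refl
punchIn-right-deleteLeft         (r∷ κ@(r∷ _)) a       (suc c) = cong suc (punchIn-right-deleteLeft κ a c)

private
  module DeleteLeftSign {m p n} (κ : Shuffle (suc m) p (suc n)) (a : Fin (suc m)) where
    x = sign (toℕ (left κ a))
    d = shuffleSign (deleteLeft κ a)
    k = shuffleSign κ
    y = sign (toℕ a)

    past-left : x * d ≡ k * y → -1ℤ * x * d ≡ k * (-1ℤ * y)
    past-left eq = begin
      -1ℤ * x * d      ≡⟨ ℤ.*-assoc -1ℤ x d ⟩
      -1ℤ * (x * d)    ≡⟨ cong (-1ℤ *_) eq ⟩
      -1ℤ * (k * y)    ≡⟨ lemma k y ⟩
      k * (-1ℤ * y)    ∎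
      where
      open ≡-Reasoning
      lemma : ∀ k y → -1ℤ * (k * y) ≡ k * (-1ℤ * y)
      lemma = solve-∀

    past-right : ∀ s → x * d ≡ k * y → -1ℤ * x * (s * d) ≡ -1ℤ * s * k * y
    past-right s eq = begin
      -1ℤ * x * (s * d)    ≡⟨ lemma x s d ⟩
      -1ℤ * s * (x * d)    ≡⟨ cong (-1ℤ * s *_) eq ⟩
      -1ℤ * s * (k * y)    ≡⟨ ℤ.*-assoc (-1ℤ * s) k y ⟨
      -1ℤ * s * k * y      ∎
      where
      open ≡-Reasoning
      lemma : ∀ x s d → -1ℤ * x * (s * d) ≡ -1ℤ * s * (x * d)
      lemma = solve-∀

open DeleteLeftSign using (past-left; past-right)

sign-deleteLeft : ∀ {m p n} (κ : Shuffle (suc m) p (suc n)) a →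
  sign (toℕ (left κ a)) * shuffleSign (deleteLeft κ a) ≡ shuffleSign κ * sign (toℕ a)
sign-deleteLeft         (l∷ κ)            zero    = ℤ.*-comm 1ℤ (shuffleSign κ)
sign-deleteLeft         (l∷ κ@(l∷ _))     (suc a) = past-left κ a (sign-deleteLeft κ a)
sign-deleteLeft {suc _} (l∷ κ@(r∷ _))     (suc a) = past-left κ a (sign-deleteLeft κ a)
sign-deleteLeft {m}     (r∷ κ@(l∷ _))     a       = past-right κ a (sign m) (sign-deleteLeft κ a)
sign-deleteLeft {m}     (r∷ κ@(r∷ _))     a       = past-right κ a (sign m) (sign-deleteLeft κ a)

isLeft : ∀ {m p n} → Shuffle m p n → Fin n → ℤ
isLeft (l∷ κ) zero    = 1ℤ
isLeft (r∷ κ) zero    = 0ℤ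
isLeft (l∷ κ) (suc r) = isLeft κ r
isLeft (r∷ κ) (suc r) = isLeft κ r

isLeft-left : ∀ {m p n} (κ : Shuffle m p n) a → isLeft κ (left κ a) ≡ 1ℤ
isLeft-left (l∷ κ) zero    = refl
isLeft-left (l∷ κ) (suc a) = isLeft-left κ a
isLeft-left (r∷ κ) a       = isLeft-left κ a

isLeft-right : ∀ {m p n} (κ : Shuffle m p n) c → isLeft κ (right κ c) ≡ 0ℤ
isLeft-right (l∷ κ) c       = isLeft-right κ c
isLeft-right (r∷ κ) zero    = refl
isLeft-right (r∷ κ) (suc c) = isLeft-right κ c

allRight : ∀ p → Shuffle 0 p p
allRight zero    = []
allRight (suc p) = r∷ allRight p

allLeft : ∀ m → Shuffle m 0 m
allLeft zero    = []
allLeft (suc m) = l∷ allLeft m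

left-allLeft : ∀ m a → left (allLeft m) a ≡ a
left-allLeft (suc m) zero    = refl
left-allLeft (suc m) (suc a) = cong suc (left-allLeft m a)

data LeftsFirst : ∀ {m p n} → Shuffle m p n → Set where
  rights : ∀ {p} (ρ : Shuffle 0 p p) → LeftsFirst ρ
  l∷_    : ∀ {m p n} {ρ : Shuffle m p n} → LeftsFirst ρ → LeftsFirst (l∷ ρ)

appendRight : ∀ {m p n} → Shuffle m p n → Shuffle m (suc p) (suc n)
appendRight []     = r∷ []
appendRight (l∷ κ) = l∷ appendRight κ
appendRight (r∷ κ) = r∷ appendRight κ

sortShuffle : ∀ {m p n} → Shuffle m p n → Shuffle m p n
sortShuffle []     = []
sortShuffle (l∷ κ) = l∷ sortShuffle κ
sortShuffle (r∷ κ) = appendRight (sortShuffle κ)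

leftsFirst-appendRight : ∀ {m p n} {ρ : Shuffle m p n} → LeftsFirst ρ → LeftsFirst (appendRight ρ)
leftsFirst-appendRight (rights ρ) = rights (appendRight ρ)
leftsFirst-appendRight (l∷ ρ-lf)  = l∷ leftsFirst-appendRight ρ-lf

leftsFirst-sortShuffle : ∀ {m p n} (κ : Shuffle m p n) → LeftsFirst (sortShuffle κ)
leftsFirst-sortShuffle []     = rights []
leftsFirst-sortShuffle (l∷ κ) = l∷ leftsFirst-sortShuffle κ
leftsFirst-sortShuffle (r∷ κ) = leftsFirst-appendRight (leftsFirst-sortShuffle κ)

right-rights : ∀ {p} (ρ : Shuffle 0 p p) c → right ρ c ≡ c
right-rights (r∷ ρ) zero    = refl
right-rights (r∷ ρ) (suc c) = cong suc (right-rights ρ c)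

shuffleSign-rights : ∀ {p} (ρ : Shuffle 0 p p) → shuffleSign ρ ≡ 1ℤ
shuffleSign-rights []     = refl
shuffleSign-rights (r∷ ρ) = trans (ℤ.*-identityˡ (shuffleSign ρ)) (shuffleSign-rights ρ)

extendToPermutation : ∀ {j p n} {ρ : Shuffle j (suc p) n} → LeftsFirst ρ →
  ∀ {g : Fin (suc j) → Fin n} → Injective _≡_ _≡_ g →
  ∃ λ π → Injective _≡_ _≡_ π
        × (∀ a → π (left ρ a) ≡ g (inject₁ a))
        × π (right ρ zero) ≡ g (fromℕ j)
extendToPermutation (rights (r∷ _)) {g} _ = toFront (g zero) , toFront-injective (g zero) , (λ ()) , refl
extendToPermutation {suc j} (l∷_ {ρ = ρ} ρ-lf) {g} g-injective
  with extendToPermutation ρ-lf (dropHead-injective g-injective)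
... | π , π-injective , π-left , π-right =
  toFront (g zero) ∘ Fin.lift 1 π ,
  (λ eq → lift-injective π π-injective 1 (toFront-injective (g zero) eq)) ,
  extends-left ,
  trans (cong (punchIn (g zero)) π-right) (toFront∘lift-dropHead g-injective (suc (fromℕ j)))
  where
  extends-left : ∀ a → toFront (g zero) (Fin.lift 1 π (left (l∷ ρ) a)) ≡ g (inject₁ a)
  extends-left zero    = refl
  extends-left (suc a) =
    trans (cong (punchIn (g zero)) (π-left a)) (toFront∘lift-dropHead g-injective (suc (inject₁ a)))

module _ {j d} (F : Fin j → Fin (suc d)) (F≢0 : ∀ a → zero ≢ F a) where

  predMap : Fin j → Fin d
  predMap a = punchOut (F≢0 a)

  suc-predMap : ∀ a → suc (predMap a) ≡ F a
  suc-predMap a = punchIn-punchOut (F≢0 a)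

  predMap-increasing : StrictlyIncreasing F → StrictlyIncreasing predMap
  predMap-increasing F-increasing a b a<b =
    ℕ.s<s⁻¹ (subst₂ Fin._<_ (sym (suc-predMap a)) (sym (suc-predMap b)) (F-increasing a b a<b))

increasing⇒suc≢0 : ∀ {j d} {F : Fin (suc j) → Fin (suc d)} → StrictlyIncreasing F →
  ∀ a → zero ≢ F (suc a)
increasing⇒suc≢0 {F = F} F-increasing a 0≡F =
  ℕ.n≮0 (subst (λ z → toℕ (F zero) ℕ.< toℕ z) (sym 0≡F) (F-increasing zero (suc a) (ℕ.s≤s ℕ.z≤n)))

shuffleOf : ∀ {j d} (F : Fin j → Fin d) → StrictlyIncreasing F →
  ∃ λ p → Σ (Shuffle j p d) λ κ → ∀ a → left κ a ≡ F a
shuffleOf {zero}  {d}     F _ = d , allRight d , λ ()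
shuffleOf {suc j} {zero}  F _ with F zero
... | ()
shuffleOf {suc j} {suc d} F F-increasing with F zero in F₀≡
... | zero =
  let p , κ , left-κ = shuffleOf (predMap (F ∘ suc) F∘suc≢0) (predMap-increasing (F ∘ suc) F∘suc≢0 F∘suc-increasing)
  in p , l∷ κ , λ { zero → sym F₀≡ ; (suc a) → trans (cong suc (left-κ a)) (suc-predMap (F ∘ suc) F∘suc≢0 a) }
  where
  F∘suc≢0 = increasing⇒suc≢0 F-increasing
  F∘suc-increasing : StrictlyIncreasing (F ∘ suc)
  F∘suc-increasing a b a<b = F-increasing (suc a) (suc b) (ℕ.s≤s a<b)
... | suc _ =
  let p , κ , left-κ = shuffleOf (predMap F F≢0) (predMap-increasing F F≢0 F-increasing)
  in suc p , r∷ κ , λ a → trans (cong suc (left-κ a)) (suc-predMap F F≢0 a)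
  where
  F≢0 : ∀ a → zero ≢ F a
  F≢0 zero    0≡F₀ with trans 0≡F₀ F₀≡
  ... | ()
  F≢0 (suc a) = increasing⇒suc≢0 F-increasing a

-- Block-triangular matrices

det-blockTriangular : ∀ {m p n} {ρ : Shuffle m p n} → LeftsFirst ρ → (κ : Shuffle m p n) (M : Matrix n) →
  (∀ a c → M (left ρ a) (right κ c) ≡ 0ℤ) →
  det n M ≡ shuffleSign κ * det m (λ a b → M (left ρ a) (left κ b)) * det p (λ x y → M (right ρ x) (right κ y))
det-blockTriangular {p = p} (rights ρ) κ M _ = begin
  det p M
    ≡⟨ det-cong p (λ x y → cong₂ M (sym (right-rights ρ x)) (sym (right-rights κ y))) ⟩
  det p B
    ≡⟨ ℤ.*-identityˡ (det p B) ⟨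
  1ℤ * det p B
    ≡⟨ cong (λ s → s * 1ℤ * det p B) (shuffleSign-rights κ) ⟨
  shuffleSign κ * 1ℤ * det p B
    ∎
  where
  open ≡-Reasoning
  B : Matrix p
  B x y = M (right ρ x) (right κ y)
det-blockTriangular {suc m} {p} {suc n} (l∷_ {ρ = ρ} ρ-lf) κ M zeroBlock = begin
  det (suc n) M
    ≡⟨ det-laplace M ⟩
  ∑[ k < suc n ] laplaceTerm M k
    ≡⟨ ∑-shuffle κ (laplaceTerm M) ⟩
  ∑[ a < suc m ] laplaceTerm M (left κ a) + ∑[ c < p ] laplaceTerm M (right κ c)
    ≡⟨ cong₂ _+_ (sum-cong-≗ leftTerm) (∑-zero rightTerm) ⟩
  ∑[ a < suc m ] (σB * laplaceTerm A a) + 0ℤ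
    ≡⟨ ℤ.+-identityʳ (∑[ a < suc m ] (σB * laplaceTerm A a)) ⟩
  ∑[ a < suc m ] (σB * laplaceTerm A a)
    ≡⟨ *-distribˡ-sum σB (laplaceTerm A) ⟨
  σB * ∑[ a < suc m ] laplaceTerm A a
    ≡⟨ cong (σB *_) (det-laplace A) ⟨
  σB * det (suc m) A
    ≡⟨ lemma (shuffleSign κ) (det p B) (det (suc m) A) ⟩
  shuffleSign κ * det (suc m) A * det p B
    ∎
  where
  open ≡-Reasoning
  A : Matrix (suc m)
  A a b = M (left (l∷ ρ) a) (left κ b)
  B : Matrix p
  B x y = M (right (l∷ ρ) x) (right κ y)
  σB = shuffleSign κ * det p B

  lemma : ∀ s b a → s * b * a ≡ s * a * b
  lemma = solve-∀

  rightTerm : ∀ c → laplaceTerm M (right κ c) ≡ 0ℤ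
  rightTerm c = begin
    sign (toℕ (right κ c)) * (M zero (right κ c) * det n (minor M (right κ c)))
      ≡⟨ cong (λ z → sign (toℕ (right κ c)) * (z * det n (minor M (right κ c)))) (zeroBlock zero c) ⟩
    sign (toℕ (right κ c)) * 0ℤ
      ≡⟨ ℤ.*-zeroʳ (sign (toℕ (right κ c))) ⟩
    0ℤ ∎

  minor-det : ∀ a → det n (minor M (left κ a)) ≡ shuffleSign (deleteLeft κ a) * det m (minor A a) * det p B
  minor-det a = trans
    (det-blockTriangular ρ-lf (deleteLeft κ a) (minor M (left κ a))
      (λ x c → trans (cong (M (suc (left ρ x))) (punchIn-right-deleteLeft κ a c)) (zeroBlock (suc x) c)))
    (cong₂ (λ DA DB → shuffleSign (deleteLeft κ a) * DA * DB)
      (det-cong m (λ x b → cong (M (suc (left ρ x))) (punchIn-left-deleteLeft κ a b)))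
      (det-cong p (λ x y → cong (M (suc (right ρ x))) (punchIn-right-deleteLeft κ a y))))

  leftTerm : ∀ a → laplaceTerm M (left κ a) ≡ σB * laplaceTerm A a
  leftTerm a = begin
    s * (M zero (left κ a) * det n (minor M (left κ a)))
      ≡⟨ cong (λ D → s * (M zero (left κ a) * D)) (minor-det a) ⟩
    s * (M zero (left κ a) * (σ′ * det m (minor A a) * det p B))
      ≡⟨ regroup s σ′ (M zero (left κ a)) (det m (minor A a)) (det p B) ⟩
    s * σ′ * (det p B * (M zero (left κ a) * det m (minor A a)))
      ≡⟨ cong (_* (det p B * (M zero (left κ a) * det m (minor A a)))) (sign-deleteLeft κ a) ⟩
    shuffleSign κ * sign (toℕ a) * (det p B * (M zero (left κ a) * det m (minor A a)))
      ≡⟨ regroup′ (shuffleSign κ) (sign (toℕ a)) (det p B) (M zero (left κ a)) (det m (minor A a)) ⟩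
    σB * laplaceTerm A a ∎
    where
    s = sign (toℕ (left κ a))
    σ′ = shuffleSign (deleteLeft κ a)
    regroup : ∀ s σ′ x DA DB → s * (x * (σ′ * DA * DB)) ≡ s * σ′ * (DB * (x * DA))
    regroup = solve-∀
    regroup′ : ∀ σ t DB x DA → σ * t * (DB * (x * DA)) ≡ σ * DB * (t * (x * DA))
    regroup′ = solve-∀

edgeMatrix : ∀ {j p n} → Shuffle j p n → (Fin (suc n) → Fin n → ℤ) → (Fin (suc j) → Fin (suc n)) → Matrix j
edgeMatrix {j} κ x g a b = x (g (inject₁ a)) (left κ b) - x (g (fromℕ j)) (left κ b)

-- The rows g are moved to the top, g (fromℕ j) last among them, and row g (fromℕ j) is subtracted
-- from the j rows above it.  σ enumerates g (fromℕ j) and the rows outside the image of g.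
det-homMatrix-split : ∀ {j p n} (κ : Shuffle j p n) (x : Fin (suc n) → Fin n → ℤ) {g : Fin (suc j) → Fin (suc n)} →
  Injective _≡_ _≡_ g → (∀ i c → x (g i) (right κ c) ≡ x (g (fromℕ j)) (right κ c)) →
  ∃ λ (σ : Fin (suc p) → Fin (suc n)) →
    ∣ det (suc n) (homMatrix n x) ∣
      ≡ ∣ det j (edgeMatrix κ x g) ∣ ℕ.* ∣ det (suc p) (homMatrix p (λ i c → x (σ i) (right κ c))) ∣
det-homMatrix-split {j} {p} {n} κ x {g} g-injective sameOutside
  with extendToPermutation (leftsFirst-sortShuffle (r∷ κ)) g-injective
... | π , π-injective , π-left , π-right with det-permute (suc n) π-injective
... | c , ∣c∣≡1 , π-scales = π ∘ right ρ , (begin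
  ∣ det (suc n) H ∣
    ≡⟨ ∣u*i∣≡∣i∣ c (det (suc n) H) ∣c∣≡1 ⟨
  ∣ c * det (suc n) H ∣
    ≡⟨ cong ∣_∣ (π-scales .det-∘ H) ⟨
  ∣ det (suc n) (H ∘ π) ∣
    ≡⟨ cong ∣_∣ (det-subtractRow (suc n) (H ∘ π) (right ρ zero) (isLeft ρ) (isLeft-right ρ zero)) ⟨
  ∣ det (suc n) K ∣
    ≡⟨ cong ∣_∣ (det-blockTriangular (leftsFirst-sortShuffle (r∷ κ)) (r∷ κ) K zeroBlock) ⟩
  ∣ shuffleSign (r∷ κ) * det j A * det (suc p) B ∣
    ≡⟨ ∣unit*i*j∣ (shuffleSign (r∷ κ)) (det j A) (det (suc p) B) (∣shuffleSign∣≡1 (r∷ κ)) ⟩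
  ∣ det j A ∣ ℕ.* ∣ det (suc p) B ∣
    ≡⟨ cong₂ (λ DA DB → ∣ DA ∣ ℕ.* ∣ DB ∣) (det-cong j A≡edge) (det-cong (suc p) B≡hom) ⟩
  ∣ det j (edgeMatrix κ x g) ∣ ℕ.* ∣ det (suc p) (homMatrix p (λ i c → x (π (right ρ i)) (right κ c))) ∣
    ∎)
  where
  open ≡-Reasoning
  ρ = sortShuffle (r∷ κ)
  H = homMatrix n x

  K : Matrix (suc n)
  K r col = H (π r) col - isLeft ρ r * H (π (right ρ zero)) col
  A : Matrix j
  A a b = K (left ρ a) (left (r∷ κ) b)
  B : Matrix (suc p)
  B y z = K (right ρ y) (right (r∷ κ) z)

  zeroBlock : ∀ a c → K (left ρ a) (right (r∷ κ) c) ≡ 0ℤ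
  zeroBlock a zero    rewrite isLeft-left ρ a = refl
  zeroBlock a (suc c) rewrite isLeft-left ρ a | π-left a | π-right | sameOutside (inject₁ a) c =
    lemma (x (g (fromℕ j)) (right κ c))
    where
    lemma : ∀ y → y - 1ℤ * y ≡ 0ℤ
    lemma = solve-∀

  A≡edge : ∀ a b → A a b ≡ edgeMatrix κ x g a b
  A≡edge a b rewrite isLeft-left ρ a | π-left a | π-right =
    cong (λ z → x (g (inject₁ a)) (left κ b) - z) (ℤ.*-identityˡ (x (g (fromℕ j)) (left κ b)))

  B≡hom : ∀ y z → B y z ≡ homMatrix p (λ i c → x (π (right ρ i)) (right κ c)) y z
  B≡hom y zero    rewrite isLeft-right ρ y = refl
  B≡hom y (suc c) rewrite isLeft-right ρ y = ℤ.+-identityʳ (x (π (right ρ y)) (right κ c))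

bitRows : Bool → Bool → Fin 2 → Fin 1 → ℤ
bitRows b₀ b₁ zero       _ = bit b₀
bitRows b₀ b₁ (suc zero) _ = bit b₁

∣det-homMatrix-bitRows∣≡1 : ∀ b₀ b₁ → det 2 (homMatrix 1 (bitRows b₀ b₁)) ≢ 0ℤ →
  ∣ det 2 (homMatrix 1 (bitRows b₀ b₁)) ∣ ≡ 1
∣det-homMatrix-bitRows∣≡1 true  true  det≢0 = ⊥-elim (det≢0 refl)
∣det-homMatrix-bitRows∣≡1 false false det≢0 = ⊥-elim (det≢0 refl)
∣det-homMatrix-bitRows∣≡1 true  false _     = refl
∣det-homMatrix-bitRows∣≡1 false true  _     = refl

∣det-homMatrix-bits∣≡1 : ∀ {p} → p ≡ 1 → (y : Fin (suc p) → Fin p → Bool) →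
  det (suc p) (homMatrix p (λ i c → bit (y i c))) ≢ 0ℤ →
  ∣ det (suc p) (homMatrix p (λ i c → bit (y i c))) ∣ ≡ 1
∣det-homMatrix-bits∣≡1 refl y det≢0 =
  trans (cong ∣_∣ det≡) (∣det-homMatrix-bitRows∣≡1 b₀ b₁ (det≢0 ∘ trans det≡))
  where
  b₀ = y zero zero
  b₁ = y (suc zero) zero
  entries≡ : ∀ i k → homMatrix 1 (λ i c → bit (y i c)) i k ≡ homMatrix 1 (bitRows b₀ b₁) i k
  entries≡ i          zero       = refl
  entries≡ zero       (suc zero) = refl
  entries≡ (suc zero) (suc zero) = refl
  det≡ : det 2 (homMatrix 1 (λ i c → bit (y i c))) ≡ det 2 (homMatrix 1 (bitRows b₀ b₁))
  det≡ = det-cong 2 entries≡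

module _ {d} (v : Fin (suc d) → Point d) {j} {f : Fin (suc j) → Fin (suc d)}
         {F : Fin j → Fin d} {p} (κ : Shuffle j p d) (left-κ : ∀ a → left κ a ≡ F a) where

  private
    x : Fin (suc d) → Fin d → ℤ
    x i c = bit (v i c)

    E : Matrix j
    E = edgeMatrix κ x f

  -- The splitting of the face's own matrix, all of whose j coordinates are free: B = (1).
  faceClass≡∣det-edgeMatrix∣ : faceClass j F (v ∘ f) ≡ ∣ det j E ∣
  faceClass≡∣det-edgeMatrix∣ = begin
    faceClass j F (v ∘ f)
      ≡⟨ proj₂ (det-homMatrix-split (allLeft j) xF {g = λ i → i} (λ eq → eq) (λ _ ())) ⟩
    ∣ det j (edgeMatrix (allLeft j) xF (λ i → i)) ∣ ℕ.* 1
      ≡⟨ ℕ.*-identityʳ ∣ det j (edgeMatrix (allLeft j) xF (λ i → i)) ∣ ⟩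
    ∣ det j (edgeMatrix (allLeft j) xF (λ i → i)) ∣
      ≡⟨ cong ∣_∣ (det-cong j λ a b → cong (λ c → bit (v (f (inject₁ a)) c) - bit (v (f (fromℕ j)) c))
                                           (trans (cong F (left-allLeft j b)) (sym (left-κ b)))) ⟩
    ∣ det j E ∣
      ∎
    where
    open ≡-Reasoning
    xF : Fin (suc j) → Fin j → ℤ
    xF i a = bit (v (f i) (F a))

  module _ (f-injective : Injective _≡_ _≡_ f) (face : InCubeFace F (v ∘ f)) where

    simplexClass-factors : ∃ λ (y : Fin (suc p) → Fin p → Bool) →
      simplexClass d v ≡ ∣ det j E ∣ ℕ.* ∣ det (suc p) (homMatrix p (λ i c → bit (y i c))) ∣
    simplexClass-factors =
      let σ , simplex≡ = det-homMatrix-split κ x f-injective sameOutside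
      in (λ i c → v (σ i) (right κ c)) , simplex≡
      where
      sameOutside : ∀ i c → x (f i) (right κ c) ≡ x (f (fromℕ j)) (right κ c)
      sameOutside i c = cong bit (trans (face (right κ c) notFree i) (sym (face (right κ c) notFree (fromℕ j))))
        where
        notFree : InImage F (right κ c) → ⊥
        notFree (a , Fa≡) = left≢right κ a c (trans (left-κ a) Fa≡)

    faceClass∣simplexClass : faceClass j F (v ∘ f) ∣ simplexClass d v
    faceClass∣simplexClass =
      let y , simplex≡ = simplexClass-factors
      in subst₂ _∣_ (sym faceClass≡∣det-edgeMatrix∣) (sym simplex≡)
                (m∣m*n ∣ det (suc p) (homMatrix p (λ i c → bit (y i c))) ∣)

    faceClass≡simplexClass : Nondegenerate d v → suc j ≡ d → faceClass j F (v ∘ f) ≡ simplexClass d v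
    faceClass≡simplexClass nondegenerate suc-j≡d = let y , simplex≡ = simplexClass-factors in begin
      faceClass j F (v ∘ f)
        ≡⟨ faceClass≡∣det-edgeMatrix∣ ⟩
      ∣ det j E ∣
        ≡⟨ ℕ.*-identityʳ ∣ det j E ∣ ⟨
      ∣ det j E ∣ ℕ.* 1
        ≡⟨ cong (∣ det j E ∣ ℕ.*_) (∣det-homMatrix-bits∣≡1 p≡1 y (B≢0 y simplex≡)) ⟨
      ∣ det j E ∣ ℕ.* ∣ det (suc p) (homMatrix p (λ i c → bit (y i c))) ∣
        ≡⟨ simplex≡ ⟨
      simplexClass d v
        ∎
      where
      open ≡-Reasoning
      p≡1 : p ≡ 1
      p≡1 = ℕ.+-cancelˡ-≡ j p 1 (trans (sym (shuffle-size κ)) (trans (sym suc-j≡d) (ℕ.+-comm 1 j)))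
      B≢0 : ∀ y → simplexClass d v ≡ ∣ det j E ∣ ℕ.* ∣ det (suc p) (homMatrix p (λ i c → bit (y i c))) ∣ →
        det (suc p) (homMatrix p (λ i c → bit (y i c))) ≢ 0ℤ
      B≢0 y simplex≡ B≡0 = nondegenerate (ℤ.∣i∣≡0⇒i≡0 (begin
        simplexClass d v                                                   ≡⟨ simplex≡ ⟩
        ∣ det j E ∣ ℕ.* ∣ det (suc p) (homMatrix p (λ i c → bit (y i c))) ∣ ≡⟨ cong (λ D → ∣ det j E ∣ ℕ.* ∣ D ∣) B≡0 ⟩
        ∣ det j E ∣ ℕ.* 0                                                   ≡⟨ ℕ.*-zeroʳ ∣ det j E ∣ ⟩
        0                                                                  ∎))

mainTheorem6 : (d : ℕ) (v : Fin (suc d) → Point d) → Nondegenerate d v →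
    (j : ℕ) (f : Fin (suc j) → Fin (suc d)) → Injective _≡_ _≡_ f →
    (F : Fin j → Fin d) → StrictlyIncreasing F →
    InCubeFace F (λ i → v (f i)) →
    (faceClass j F (λ i → v (f i)) ∣ simplexClass d v)
      × (suc j ≡ d → faceClass j F (λ i → v (f i)) ≡ simplexClass d v)
mainTheorem6 d v nondegenerate j f f-injective F F-increasing face with shuffleOf F F-increasing
... | p , κ , left-κ =
  faceClass∣simplexClass v κ left-κ f-injective face ,
  faceClass≡simplexClass v κ left-κ f-injective face nondegenerate
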